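{- Let $n\ge 1$ and $0\le d\le n-1$. The maximum of $w(\pi)$ over all $\pi\in S_n$ with exactly $d$ descents is $d(n-1-d)$, and this maximum is attained only by the permutation $1\,2\,\cdots\,(n-d-1)\;n\;(n-1)\,\cdots\,(n-d)$.
   Context: For a word $\sigma$ of distinct positive integers, $\mathrm{des}(\sigma)$ is its number of descents (adjacent positions $i$ with $\sigma_i>\sigma_{i+1}$) and $\mathrm{st}(\sigma)$ is its standardization (replace the $j$-th smallest letter by $j$), a permutation. The weight $w\colon S_n\to\mathbb Z_{\ge0}$ is defined recursively: if $\pi$ is the identity $12\cdots n$ or the decreasing permutation $n(n-1)\cdots1$, then $w(\pi)=0$. Otherwise form the word $\pi(1)\cdots\pi(n)(n+1)$ and write it as $\pi_L\cdot 1\cdot\pi_R$, where $\pi_L$ is the (possibly empty) subword left of the letter $1$ and $\pi_R$ the subword right of $1$ (ending in $n+1$). Decompose $\pi_L=\pi_1\cdots\pi_l$: $\pi_1$ is the prefix of $\pi_L$ ending at its largest letter, $\pi_2$ the prefix of the remaining word ending at its largest letter, and so on. Then $w(\pi)=w(\mathrm{st}(\pi_R))+\mathrm{des}(\pi_R)+\sum_{i=1}^{l}\bigl(w(\mathrm{st}(\pi_i))+\mathrm{des}(\pi_i)\bigr)$. -}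

module Defs where

open import Data.Nat using (ℕ; zero; suc; _+_; _*_; _∸_; _<ᵇ_; _≡ᵇ_; _≤_)
open import Data.Bool using (Bool; true; false; if_then_else_; _∧_)
open import Data.List using (List; []; _∷_; _++_; [_]; length; map; upTo; reverse; foldr)
open import Data.Nat.ListAction using (sum)
open import Data.Product using (_×_; _,_)
open import Data.List.Relation.Binary.Permutation.Propositional using (_↭_)

-- Permutations of [n] in one-line notation: lists that are a rearrangement of 1,2,...,n
oneToN : ℕ → List ℕ
oneToN n = map suc (upTo n)

IsPerm : ℕ → List ℕ → Set
IsPerm n π = π ↭ oneToN n

des : List ℕ → ℕ
des [] = 0
des (x ∷ []) = 0
des (x ∷ y ∷ ys) = (if y <ᵇ x then 1 else 0) + des (y ∷ ys)

countLess : ℕ → List ℕ → ℕ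
countLess x [] = 0
countLess x (y ∷ ys) = (if y <ᵇ x then 1 else 0) + countLess x ys

st : List ℕ → List ℕ
st σ = map (λ x → suc (countLess x σ)) σ

eqList : List ℕ → List ℕ → Bool
eqList [] [] = true
eqList (x ∷ xs) (y ∷ ys) = (x ≡ᵇ y) ∧ eqList xs ys
eqList _ _ = false

isIdOrDec : List ℕ → Bool
isIdOrDec π = if eqList π (oneToN (length π)) then true
              else eqList π (reverse (oneToN (length π)))

splitAtOne : List ℕ → List ℕ × List ℕ
splitAtOne [] = [] , []
splitAtOne (x ∷ xs) with x ≡ᵇ 1
... | true = [] , xs
... | false with splitAtOne xs
...   | (l , r) = x ∷ l , r

maxL : List ℕ → ℕ
maxL = foldr (λ x m → if m <ᵇ x then x else m) 0

splitAfter : ℕ → List ℕ → List ℕ × List ℕ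
splitAfter m [] = [] , []
splitAfter m (x ∷ xs) with x ≡ᵇ m
... | true = [ x ] , xs
... | false with splitAfter m xs
...   | (p , r) = x ∷ p , r

-- decomposition π_L = π_1 ⋯ π_l : repeatedly cut the prefix ending at the largest letter
-- (fuel = length suffices, since each block is nonempty)
blocksF : ℕ → List ℕ → List (List ℕ)
blocksF zero _ = []
blocksF (suc f) [] = []
blocksF (suc f) xs with splitAfter (maxL xs) xs
... | (p , r) = p ∷ blocksF f r

blocks : List ℕ → List (List ℕ)
blocks xs = blocksF (length xs) xs

-- Each recursive call is on a permutation of length < n,
-- except when π starts with 1 (then st(π_R) has length n but its prefix 1 2 ... k shrinks);
-- at most n calls happen per length, so fuel n * n + 1 always suffices.
wF : ℕ → List ℕ → ℕ
wF zero _ = 0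
wF (suc f) π with isIdOrDec π
... | true = 0
... | false with splitAtOne (π ++ [ suc (length π) ])
...   | (πL , πR) =
        wF f (st πR) + des πR + sum (map (λ b → wF f (st b) + des b) (blocks πL))

w : List ℕ → ℕ
w π = wF (length π * length π + 1) π

extremal : ℕ → ℕ → List ℕ
extremal n d = oneToN (n ∸ d ∸ 1) ++ reverse (map (λ i → n ∸ d + i) (upTo (suc d)))

-- Let d = des π and a = n − 1 − d be the numbers of descents and ascents of π.  We show w(π) ≤ d a, with
-- equality only if π has extremal shape: every letter is smaller than all later ones, up to a final
-- decreasing run.  Since the recursion appends the new maximum n + 1 and standardizes π_R, the bound is
-- proved for words τ υ whose tail υ consists of left-to-right maxima: such a tail changes neither the
-- descents nor the bound of τ.  In a recursive step π_L splits into l blocks, each ending at its maximum,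
-- which is followed by a descent; by induction the term of a block with eᵢ descents and pᵢ ascents is at
-- most eᵢ pᵢ, and that of π_R at most e p, where e and p count the descents and ascents of the part of τ
-- from the letter 1 on.  Then Σ eᵢ pᵢ + e p ≤ (Σ eᵢ + e)(Σ pᵢ + p) ≤ (Σ eᵢ + l + e)(Σ pᵢ + p) = d a,
-- and the last step is strict when l > 0 and a > 0.  The extremal permutation starts with 1, so removing
-- the first letter of its increasing prefix lowers w by exactly d, whence w = d a there; and two words
-- of extremal shape with the same letters and number of descents coincide.

module Submission where

open import Defs
open import Data.Nat using (ℕ; zero; suc; _+_; _*_; _∸_; _≤_; _<_; _<ᵇ_; _≡ᵇ_; z≤n; s≤s; _≤?_; _<?_)
open import Data.Nat.Properties
open import Data.Bool using (true; false; if_then_else_; T)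
open import Data.List using (List; []; _∷_; _++_; [_]; length; map; upTo; reverse)
import Data.List.Properties as List
open import Data.Nat.ListAction using (sum)
open import Data.List.Relation.Unary.All as All using (All; []; _∷_)
import Data.List.Relation.Unary.All.Properties as All
open import Data.List.Relation.Unary.AllPairs as AllPairs using ([]; _∷_)
open import Data.List.Relation.Unary.Unique.Propositional using (Unique)
import Data.List.Relation.Unary.Unique.Propositional.Properties as Unique
open import Data.List.Membership.Propositional using (_∈_)
open import Data.List.Membership.Propositional.Properties using (∈-++⁺ˡ; ∈-++⁺ʳ; ∈-map⁺)
open import Data.List.Relation.Unary.Any using (here; there)
open import Data.List.Relation.Binary.Permutation.Propositional using (_↭_; ↭-sym; ↭-trans; prep; swap; ↭⇒↭ₛ)
import Data.List.Relation.Binary.Permutation.Propositional as Perm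
import Data.List.Relation.Binary.Permutation.Propositional.Properties as Perm
import Data.List.Relation.Binary.Permutation.Setoid.Properties as Permₛ
open import Data.Product using (Σ-syntax; _×_; _,_; proj₁; proj₂)
open import Data.Sum using (_⊎_; inj₁; inj₂)
open import Data.Empty using (⊥-elim)
open import Data.Unit using (⊤; tt)
open import Relation.Nullary using (yes; no)
open import Relation.Binary using (tri<; tri≈; tri>)
open import Relation.Binary.PropositionalEquality hiding ([_])
open import Data.Nat.Tactic.RingSolver using (solve-∀)
open import Function using (case_of_; _∘_)

<⇒<ᵇ≡true : ∀ {m n} → m < n → (m <ᵇ n) ≡ true
<⇒<ᵇ≡true {zero} {suc n} _ = refl
<⇒<ᵇ≡true {suc m} {suc n} (s≤s m<n) = <⇒<ᵇ≡true m<n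

≥⇒<ᵇ≡false : ∀ {m n} → n ≤ m → (m <ᵇ n) ≡ false
≥⇒<ᵇ≡false {m} {zero} _ = refl
≥⇒<ᵇ≡false {suc m} {suc n} (s≤s n≤m) = ≥⇒<ᵇ≡false n≤m

<ᵇ≡true⇒< : ∀ m n → (m <ᵇ n) ≡ true → m < n
<ᵇ≡true⇒< m n e = <ᵇ⇒< m n (subst T (sym e) tt)

<ᵇ≡false⇒≥ : ∀ m n → (m <ᵇ n) ≡ false → n ≤ m
<ᵇ≡false⇒≥ m n e = ≮⇒≥ (λ m<n → subst T e (<⇒<ᵇ m<n))

≡ᵇ≡true⇒≡ : ∀ m n → (m ≡ᵇ n) ≡ true → m ≡ n
≡ᵇ≡true⇒≡ m n e = ≡ᵇ⇒≡ m n (subst T (sym e) tt)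

≡ᵇ≡false⇒≢ : ∀ m n → (m ≡ᵇ n) ≡ false → m ≢ n
≡ᵇ≡false⇒≢ m n e m≡n = subst T e (≡⇒≡ᵇ m n m≡n)

-- The summand of des and of countLess in Defs, which therefore unfold to it definitionally.
descent : ℕ → ℕ → ℕ
descent a b = if b <ᵇ a then 1 else 0

descent-< : ∀ {a b} → a < b → descent a b ≡ 0
descent-< a<b rewrite ≥⇒<ᵇ≡false (<⇒≤ a<b) = refl

descent-> : ∀ {a b} → b < a → descent a b ≡ 1
descent-> b<a rewrite <⇒<ᵇ≡true b<a = refl

descent≤1 : ∀ a b → descent a b ≤ 1
descent≤1 a b with b <ᵇ a
... | true = ≤-refl
... | false = z≤n

descent≡0⇒≤ : ∀ a b → descent a b ≡ 0 → a ≤ b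
descent≡0⇒≤ a b e with b <? a
... | yes b<a rewrite <⇒<ᵇ≡true b<a = ⊥-elim (1+n≢0 e)
... | no b≮a = ≮⇒≥ b≮a

des-∷≤length : ∀ x xs → des (x ∷ xs) ≤ length xs
des-∷≤length x [] = z≤n
des-∷≤length x (y ∷ ys) = +-mono-≤ (descent≤1 x y) (des-∷≤length y ys)

des≤length : ∀ τ → des τ ≤ length τ
des≤length [] = z≤n
des≤length (x ∷ xs) = m≤n⇒m≤1+n (des-∷≤length x xs)

des-tail≤ : ∀ x xs → des xs ≤ des (x ∷ xs)
des-tail≤ x [] = z≤n
des-tail≤ x (y ∷ ys) = m≤n+m _ _

des-∷-< : ∀ x xs → All (x <_) xs → des (x ∷ xs) ≡ des xs
des-∷-< x [] _ = refl
des-∷-< x (y ∷ ys) (x<y ∷ _) = cong (_+ des (y ∷ ys)) (descent-< x<y)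

des-∷ʳ-> : ∀ {y} xs → All (_< y) xs → des (xs ++ [ y ]) ≡ des xs
des-∷ʳ-> [] _ = refl
des-∷ʳ-> (x ∷ []) (x<y ∷ _) = cong (_+ 0) (descent-< x<y)
des-∷ʳ-> (x ∷ x′ ∷ xs) (_ ∷ ps) = cong (descent x x′ +_) (des-∷ʳ-> (x′ ∷ xs) ps)

des-++-∷-∷ : ∀ xs a b ys → des (xs ++ a ∷ b ∷ ys) ≡ des (xs ++ [ a ]) + (descent a b + des (b ∷ ys))
des-++-∷-∷ [] a b ys = refl
des-++-∷-∷ (x ∷ []) a b ys = cong (_+ (descent a b + des (b ∷ ys))) (sym (+-identityʳ (descent x a)))
des-++-∷-∷ (x ∷ x′ ∷ xs) a b ys =
  trans (cong (descent x x′ +_) (des-++-∷-∷ (x′ ∷ xs) a b ys)) (sym (+-assoc (descent x x′) _ _))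

All-map-on : ∀ {P Q : ℕ → Set} {g : ℕ → ℕ} xs → (∀ {x} → x ∈ xs → P x → Q (g x)) → All P xs → All Q (map g xs)
All-map-on xs f ps = All.map⁺ (All.tabulate (λ x∈xs → f x∈xs (All.lookup ps x∈xs)))

All-map-on⁻ : ∀ {P Q : ℕ → Set} {g : ℕ → ℕ} xs → (∀ {x} → x ∈ xs → Q (g x) → P x) → All Q (map g xs) → All P xs
All-map-on⁻ xs f qs = All.tabulate (λ x∈xs → f x∈xs (All.lookup (All.map⁻ qs) x∈xs))

length-∷ʳ : ∀ (xs : List ℕ) x → length (xs ++ [ x ]) ≡ suc (length xs)
length-∷ʳ xs x = trans (List.length-++ xs) (+-comm (length xs) 1)

Unique-++⁻ˡ : ∀ (xs : List ℕ) {ys} → Unique (xs ++ ys) → Unique xs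
Unique-++⁻ˡ [] _ = []
Unique-++⁻ˡ (x ∷ xs) (x∉ ∷ u) = All.++⁻ˡ xs x∉ ∷ Unique-++⁻ˡ xs u

Unique-++⁻ʳ : ∀ (xs : List ℕ) {ys} → Unique (xs ++ ys) → Unique ys
Unique-++⁻ʳ [] u = u
Unique-++⁻ʳ (x ∷ xs) (_ ∷ u) = Unique-++⁻ʳ xs u

Unique-∷ʳ : ∀ (xs : List ℕ) {z} → Unique xs → All (_≢ z) xs → Unique (xs ++ [ z ])
Unique-∷ʳ [] _ _ = [] ∷ []
Unique-∷ʳ (x ∷ xs) (x∉ ∷ u) (x≢z ∷ ps) = All.++⁺ x∉ (x≢z ∷ []) ∷ Unique-∷ʳ xs u ps

Unique-resp-↭ : ∀ {xs ys : List ℕ} → xs ↭ ys → Unique xs → Unique ys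
Unique-resp-↭ p = Permₛ.Unique-resp-↭ (setoid ℕ) (↭⇒↭ₛ p)

MonotoneOn : List ℕ → (ℕ → ℕ) → Set
MonotoneOn S g = ∀ {x y} → x ∈ S → y ∈ S → x < y → g x < g y

module _ {S : List ℕ} {g : ℕ → ℕ} (mono : MonotoneOn S g) where

  MonotoneOn-⊆ : ∀ {S′} → (∀ {x} → x ∈ S′ → x ∈ S) → MonotoneOn S′ g
  MonotoneOn-⊆ sub x∈ y∈ = mono (sub x∈) (sub y∈)

  MonotoneOn-reflects-< : ∀ {x y} → x ∈ S → y ∈ S → g x < g y → x < y
  MonotoneOn-reflects-< {x} {y} x∈ y∈ gx<gy with <-cmp x y
  ... | tri< x<y _ _ = x<y
  ... | tri≈ _ refl _ = ⊥-elim (<-irrefl refl gx<gy)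
  ... | tri> _ _ y<x = ⊥-elim (<-asym gx<gy (mono y∈ x∈ y<x))

  MonotoneOn-injective : ∀ {x y} → x ∈ S → y ∈ S → x ≢ y → g x ≢ g y
  MonotoneOn-injective {x} {y} x∈ y∈ x≢y gx≡gy with <-cmp x y
  ... | tri< x<y _ _ = <-irrefl gx≡gy (mono x∈ y∈ x<y)
  ... | tri≈ _ x≡y _ = x≢y x≡y
  ... | tri> _ _ y<x = <-irrefl (sym gx≡gy) (mono y∈ x∈ y<x)

  descent-MonotoneOn : ∀ {x y} → x ∈ S → y ∈ S → descent (g x) (g y) ≡ descent x y
  descent-MonotoneOn {x} {y} x∈ y∈ with y <? x
  ... | yes y<x rewrite <⇒<ᵇ≡true y<x | <⇒<ᵇ≡true (mono y∈ x∈ y<x) = refl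
  ... | no y≮x rewrite ≥⇒<ᵇ≡false (≮⇒≥ y≮x)
                     | ≥⇒<ᵇ≡false (≮⇒≥ (λ gy<gx → y≮x (MonotoneOn-reflects-< y∈ x∈ gy<gx))) = refl

des-map : ∀ {g} xs → MonotoneOn xs g → des (map g xs) ≡ des xs
des-map [] _ = refl
des-map (x ∷ []) _ = refl
des-map (x ∷ y ∷ ys) mono =
  cong₂ _+_ (descent-MonotoneOn mono (here refl) (there (here refl))) (des-map (y ∷ ys) (MonotoneOn-⊆ mono there))

Unique-map : ∀ {g} xs → MonotoneOn xs g → Unique xs → Unique (map g xs)
Unique-map [] _ [] = []
Unique-map (x ∷ xs) mono (x∉ ∷ u) =
  All-map-on xs (λ y∈ → MonotoneOn-injective mono (here refl) (there y∈)) x∉ ∷ Unique-map xs (MonotoneOn-⊆ mono there) u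

suc-MonotoneOn : ∀ {S} → MonotoneOn S suc
suc-MonotoneOn _ _ = s≤s

-- Left-to-right maxima

Records : List ℕ → List ℕ → Set
Records τ [] = ⊤
Records τ (y ∷ ys) = All (_< y) τ × Records (τ ++ [ y ]) ys

Records-des : ∀ τ υ → Records τ υ → des (τ ++ υ) ≡ des τ
Records-des τ [] _ = cong des (List.++-identityʳ τ)
Records-des τ (y ∷ ys) (τ<y , rec) = begin
  des (τ ++ y ∷ ys)        ≡⟨ cong des (sym (List.++-assoc τ [ y ] ys)) ⟩
  des ((τ ++ [ y ]) ++ ys) ≡⟨ Records-des (τ ++ [ y ]) ys rec ⟩
  des (τ ++ [ y ])         ≡⟨ des-∷ʳ-> τ τ<y ⟩
  des τ                    ∎
  where open ≡-Reasoning

Records-∷ʳ : ∀ τ υ z → Records τ υ → All (_< z) (τ ++ υ) → Records τ (υ ++ [ z ])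
Records-∷ʳ τ [] z _ τ<z = subst (All (_< z)) (List.++-identityʳ τ) τ<z , tt
Records-∷ʳ τ (y ∷ ys) z (τ<y , rec) τυ<z =
  τ<y , Records-∷ʳ (τ ++ [ y ]) ys z rec (subst (All (_< z)) (sym (List.++-assoc τ [ y ] ys)) τυ<z)

Records-split : ∀ τ P y Q → Records τ (P ++ y ∷ Q) → All (_< y) (τ ++ P) × Records (τ ++ P ++ [ y ]) Q
Records-split τ [] y Q (τ<y , rec) = subst (All (_< y)) (sym (List.++-identityʳ τ)) τ<y , rec
Records-split τ (x ∷ P) y Q (_ , rec) with Records-split (τ ++ [ x ]) P y Q rec
... | τP<y , recQ = subst (All (_< y)) (List.++-assoc τ [ x ] P) τP<y ,
                    subst (λ l → Records l Q) (List.++-assoc τ [ x ] (P ++ [ y ])) recQ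

Records-dropˡ : ∀ σ τ υ → Records (σ ++ τ) υ → Records τ υ
Records-dropˡ σ τ [] _ = tt
Records-dropˡ σ τ (y ∷ ys) (στ<y , rec) =
  All.++⁻ʳ σ στ<y , Records-dropˡ σ (τ ++ [ y ]) ys (subst (λ l → Records l ys) (List.++-assoc σ τ [ y ]) rec)

Records-map : ∀ {g} τ υ → MonotoneOn (τ ++ υ) g → Records τ υ → Records (map g τ) (map g υ)
Records-map τ [] _ _ = tt
Records-map {g} τ (y ∷ ys) mono (τ<y , rec) =
  All-map-on τ (λ x∈ → mono (∈-++⁺ˡ x∈) (∈-++⁺ʳ τ (here refl))) τ<y ,
  subst (λ l → Records l (map g ys)) (List.map-++ g τ [ y ])
    (Records-map (τ ++ [ y ]) ys (MonotoneOn-⊆ mono (subst (_ ∈_) (List.++-assoc τ [ y ] ys))) rec)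

rank : List ℕ → ℕ → ℕ
rank σ x = suc (countLess x σ)

countLess-mono-≤ : ∀ {x y} σ → x ≤ y → countLess x σ ≤ countLess y σ
countLess-mono-≤ [] _ = z≤n
countLess-mono-≤ {x} {y} (z ∷ σ) x≤y with z <? x | z <? y
... | yes z<x | yes z<y rewrite <⇒<ᵇ≡true z<x | <⇒<ᵇ≡true z<y = s≤s (countLess-mono-≤ σ x≤y)
... | yes z<x | no z≮y = ⊥-elim (z≮y (<-≤-trans z<x x≤y))
... | no z≮x | yes z<y rewrite ≥⇒<ᵇ≡false (≮⇒≥ z≮x) | <⇒<ᵇ≡true z<y = m≤n⇒m≤1+n (countLess-mono-≤ σ x≤y)
... | no z≮x | no z≮y rewrite ≥⇒<ᵇ≡false (≮⇒≥ z≮x) | ≥⇒<ᵇ≡false (≮⇒≥ z≮y) = countLess-mono-≤ σ x≤y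

countLess-mono-< : ∀ {x y} σ → x ∈ σ → x < y → countLess x σ < countLess y σ
countLess-mono-< {y = y} (z ∷ σ) (here refl) z<y rewrite ≥⇒<ᵇ≡false (≤-refl {z}) | <⇒<ᵇ≡true z<y =
  s≤s (countLess-mono-≤ σ (<⇒≤ z<y))
countLess-mono-< {x} {y} (z ∷ σ) (there x∈) x<y with z <? x | z <? y
... | yes z<x | yes z<y rewrite <⇒<ᵇ≡true z<x | <⇒<ᵇ≡true z<y = s≤s (countLess-mono-< σ x∈ x<y)
... | yes z<x | no z≮y = ⊥-elim (z≮y (<-trans z<x x<y))
... | no z≮x | yes z<y rewrite ≥⇒<ᵇ≡false (≮⇒≥ z≮x) | <⇒<ᵇ≡true z<y = m≤n⇒m≤1+n (countLess-mono-< σ x∈ x<y)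
... | no z≮x | no z≮y rewrite ≥⇒<ᵇ≡false (≮⇒≥ z≮x) | ≥⇒<ᵇ≡false (≮⇒≥ z≮y) = countLess-mono-< σ x∈ x<y

countLess≤length : ∀ x σ → countLess x σ ≤ length σ
countLess≤length x [] = z≤n
countLess≤length x (z ∷ σ) = +-mono-≤ (descent≤1 x z) (countLess≤length x σ)

countLess<length : ∀ {x} σ → x ∈ σ → countLess x σ < length σ
countLess<length (z ∷ σ) (here refl) rewrite ≥⇒<ᵇ≡false (≤-refl {z}) = s≤s (countLess≤length z σ)
countLess<length {x} (z ∷ σ) (there x∈) = +-mono-≤-< (descent≤1 x z) (countLess<length σ x∈)

countLess-minimum : ∀ {x} σ → All (x ≤_) σ → countLess x σ ≡ 0
countLess-minimum [] _ = refl
countLess-minimum (z ∷ σ) (x≤z ∷ x≤σ) rewrite ≥⇒<ᵇ≡false x≤z = countLess-minimum σ x≤σ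

countLess-map-suc : ∀ x σ → countLess (suc x) (map suc σ) ≡ countLess x σ
countLess-map-suc x [] = refl
countLess-map-suc x (y ∷ σ) = cong (descent x y +_) (countLess-map-suc x σ)

countLess-resp-↭ : ∀ x {σ σ′} → σ ↭ σ′ → countLess x σ ≡ countLess x σ′
countLess-resp-↭ x Perm.refl = refl
countLess-resp-↭ x (prep y p) = cong (descent x y +_) (countLess-resp-↭ x p)
countLess-resp-↭ x (swap {σ} y z p) = begin
  descent x y + (descent x z + countLess x σ) ≡⟨ sym (+-assoc (descent x y) _ _) ⟩
  descent x y + descent x z + countLess x σ   ≡⟨ cong (_+ countLess x σ) (+-comm (descent x y) (descent x z)) ⟩
  descent x z + descent x y + countLess x σ   ≡⟨ +-assoc (descent x z) _ _ ⟩
  descent x z + (descent x y + countLess x σ) ≡⟨ cong (λ c → descent x z + (descent x y + c)) (countLess-resp-↭ x p) ⟩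
  _ ∎
  where open ≡-Reasoning
countLess-resp-↭ x (Perm.trans p q) = trans (countLess-resp-↭ x p) (countLess-resp-↭ x q)

minimum-exists : ∀ z σ → Σ[ x ∈ ℕ ] (x ∈ z ∷ σ) × All (x ≤_) (z ∷ σ)
minimum-exists z [] = z , here refl , ≤-refl ∷ []
minimum-exists z (y ∷ σ) with minimum-exists y σ
... | x , x∈ , x≤ with z ≤? x
...   | yes z≤x = z , here refl , ≤-refl ∷ All.map (≤-trans z≤x) x≤
...   | no z≰x = x , there x∈ , <⇒≤ (≰⇒> z≰x) ∷ x≤

rank-MonotoneOn : ∀ σ → MonotoneOn σ (rank σ)
rank-MonotoneOn σ x∈ _ x<y = s≤s (countLess-mono-< σ x∈ x<y)

Normalized : List ℕ → Set
Normalized σ = Unique σ × All (λ x → 1 ≤ x × x ≤ length σ) σ × (σ ≡ [] ⊎ 1 ∈ σ)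

st-normalized : ∀ σ → Unique σ → Normalized (st σ)
st-normalized σ u =
  Unique-map σ (rank-MonotoneOn σ) u ,
  All.map⁺ (All.tabulate (λ x∈ → s≤s z≤n , subst (rank σ _ ≤_) (sym (List.length-map (rank σ) σ)) (countLess<length σ x∈))) ,
  contains-1 σ
  where
  contains-1 : ∀ σ → st σ ≡ [] ⊎ 1 ∈ st σ
  contains-1 [] = inj₁ refl
  contains-1 (z ∷ σ) with minimum-exists z σ
  ... | x , x∈ , x≤ = inj₂ (subst (_∈ st (z ∷ σ)) (cong suc (countLess-minimum (z ∷ σ) x≤)) (∈-map⁺ (rank (z ∷ σ)) x∈))

st-map-suc : ∀ σ → st (map suc σ) ≡ st σ
st-map-suc σ = trans (sym (List.map-∘ σ)) (List.map-cong (λ y → cong suc (countLess-map-suc y σ)) σ)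

oneToN-suc : ∀ n → oneToN (suc n) ≡ 1 ∷ map suc (oneToN n)
oneToN-suc n = cong (λ l → 1 ∷ map suc l) (sym (List.map-upTo suc n))

oneToN-∷ʳ : ∀ n → oneToN (suc n) ≡ oneToN n ++ [ suc n ]
oneToN-∷ʳ n = trans (cong (map suc) (sym (List.upTo-∷ʳ n))) (List.map-++ suc (upTo n) [ n ])

length-oneToN : ∀ n → length (oneToN n) ≡ n
length-oneToN n = trans (List.length-map suc (upTo n)) (List.length-upTo n)

oneToN-bounded : ∀ n → All (λ x → 1 ≤ x × x ≤ n) (oneToN n)
oneToN-bounded zero = []
oneToN-bounded (suc n) = subst (All (λ x → 1 ≤ x × x ≤ suc n)) (sym (oneToN-suc n))
  ((s≤s z≤n , s≤s z≤n) ∷ All.map⁺ (All.map (λ (1≤x , x≤n) → m≤n⇒m≤1+n 1≤x , s≤s x≤n) (oneToN-bounded n)))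

Unique-oneToN : ∀ n → Unique (oneToN n)
Unique-oneToN n = Unique.map⁺ suc-injective (Unique.upTo⁺ n)

countLess-oneToN : ∀ y m → y ≤ m → countLess (suc y) (oneToN m) ≡ y
countLess-oneToN zero m _ = countLess-minimum (oneToN m) (All.map proj₁ (oneToN-bounded m))
countLess-oneToN (suc y) (suc m) (s≤s y≤m) = begin
  countLess (suc (suc y)) (oneToN (suc m))        ≡⟨ cong (countLess (suc (suc y))) (oneToN-suc m) ⟩
  suc (countLess (suc (suc y)) (map suc (oneToN m))) ≡⟨ cong suc (countLess-map-suc (suc y) (oneToN m)) ⟩
  suc (countLess (suc y) (oneToN m))               ≡⟨ cong suc (countLess-oneToN y m y≤m) ⟩
  suc y                                            ∎
  where open ≡-Reasoning

st-↭-oneToN : ∀ m σ → σ ↭ oneToN m → st σ ≡ σ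
st-↭-oneToN m σ p = List.map-id-local (All.map fixed (Perm.All-resp-↭ (↭-sym p) (oneToN-bounded m)))
  where
  fixed : ∀ {x} → 1 ≤ x × x ≤ m → rank σ x ≡ x
  fixed {suc y} (_ , x≤m) = cong suc (trans (countLess-resp-↭ (suc y) p) (countLess-oneToN y m (≤-trans (n≤1+n y) x≤m)))

↭-oneToN⇒normalized : ∀ n π → π ↭ oneToN n → Normalized π × length π ≡ n
↭-oneToN⇒normalized n π p =
  (Unique-resp-↭ (↭-sym p) (Unique-oneToN n) ,
   subst (λ m → All (λ x → 1 ≤ x × x ≤ m) π) (sym len) (Perm.All-resp-↭ (↭-sym p) (oneToN-bounded n)) ,
   contains-1 n p) ,
  len
  where
  len : length π ≡ n
  len = trans (Perm.↭-length p) (length-oneToN n)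
  contains-1 : ∀ m → π ↭ oneToN m → π ≡ [] ⊎ 1 ∈ π
  contains-1 zero q = inj₁ (Perm.↭-empty-inv q)
  contains-1 (suc m) q = inj₂ (Perm.∈-resp-↭ (↭-sym q) (subst (1 ∈_) (sym (oneToN-suc m)) (here refl)))

splitAtOne-spec : ∀ xs → 1 ∈ xs → Σ[ L ∈ List ℕ ] Σ[ R ∈ List ℕ ]
  splitAtOne xs ≡ (L , R) × xs ≡ L ++ 1 ∷ R × All (_≢ 1) L
splitAtOne-spec (x ∷ xs) 1∈ with x ≡ᵇ 1 in e
... | true = [] , xs , refl , cong (_∷ xs) (≡ᵇ≡true⇒≡ x 1 e) , []
... | false with 1∈
...   | here 1≡x = ⊥-elim (≡ᵇ≡false⇒≢ x 1 e (sym 1≡x))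
...   | there 1∈xs with splitAtOne-spec xs 1∈xs
...     | L , R , split≡ , xs≡ , L≢1 rewrite split≡ =
          x ∷ L , R , refl , cong (x ∷_) xs≡ , ≡ᵇ≡false⇒≢ x 1 e ∷ L≢1

++-∷-cases : ∀ (L : List ℕ) x R τ υ → L ++ x ∷ R ≡ τ ++ υ →
  (Σ[ M ∈ List ℕ ] τ ≡ L ++ x ∷ M × R ≡ M ++ υ) ⊎ (Σ[ P ∈ List ℕ ] L ≡ τ ++ P × υ ≡ P ++ x ∷ R)
++-∷-cases L x R [] υ e = inj₂ (L , refl , sym e)
++-∷-cases [] x R (t ∷ τ) υ e with List.∷-injective e
... | refl , R≡ = inj₁ (τ , refl , R≡)
++-∷-cases (y ∷ L) x R (t ∷ τ) υ e with List.∷-injective e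
... | refl , e′ with ++-∷-cases L x R τ υ e′
...   | inj₁ (M , τ≡ , R≡) = inj₁ (M , cong (y ∷_) τ≡ , R≡)
...   | inj₂ (P , L≡ , υ≡) = inj₂ (P , cong (y ∷_) L≡ , υ≡)

splitAfter-spec : ∀ m xs → m ∈ xs → Σ[ c ∈ List ℕ ] Σ[ r ∈ List ℕ ]
  splitAfter m xs ≡ (c ++ [ m ] , r) × xs ≡ c ++ m ∷ r × All (_≢ m) c
splitAfter-spec m (x ∷ xs) m∈ with x ≡ᵇ m in e
... | true rewrite ≡ᵇ≡true⇒≡ x m e = [] , xs , refl , refl , []
... | false with m∈
...   | here m≡x = ⊥-elim (≡ᵇ≡false⇒≢ x m e (sym m≡x))
...   | there m∈xs with splitAfter-spec m xs m∈xs
...     | c , r , split≡ , xs≡ , c≢m rewrite split≡ =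
          x ∷ c , r , refl , cong (x ∷_) xs≡ , ≡ᵇ≡false⇒≢ x m e ∷ c≢m

maxL-∈ : ∀ x xs → maxL (x ∷ xs) ∈ x ∷ xs
maxL-∈ x xs with maxL xs <ᵇ x in e
... | true = here refl
maxL-∈ x [] | false = here (sym (n≤0⇒n≡0 (<ᵇ≡false⇒≥ 0 x e)))
maxL-∈ x (y ∷ ys) | false = there (maxL-∈ y ys)

maxL-≥ : ∀ xs → All (_≤ maxL xs) xs
maxL-≥ [] = []
maxL-≥ (x ∷ xs) with maxL xs <ᵇ x in e
... | true = ≤-refl ∷ All.map (λ y≤ → <⇒≤ (≤-<-trans y≤ (<ᵇ≡true⇒< _ _ e))) (maxL-≥ xs)
... | false = <ᵇ≡false⇒≥ _ _ e ∷ maxL-≥ xs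

peak-split : ∀ x xs → Unique (x ∷ xs) → let m = maxL (x ∷ xs) in Σ[ c ∈ List ℕ ] Σ[ r ∈ List ℕ ]
  splitAfter m (x ∷ xs) ≡ (c ++ [ m ] , r) × x ∷ xs ≡ c ++ m ∷ r × All (_< m) c × All (_< m) r
peak-split x xs u with splitAfter-spec (maxL (x ∷ xs)) (x ∷ xs) (maxL-∈ x xs)
... | c , r , split≡ , L≡ , c≢m =
  c , r , split≡ , L≡ ,
  All.zipWith (λ (≤m , ≢m) → ≤∧≢⇒< ≤m ≢m) (All.++⁻ˡ c ≤m , c≢m) ,
  All.zipWith (λ (≤m , m≢) → ≤∧≢⇒< ≤m (λ e → m≢ (sym e))) (All.tail (All.++⁻ʳ c ≤m) , m∉r)
  where
  m = maxL (x ∷ xs)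
  ≤m : All (_≤ m) (c ++ m ∷ r)
  ≤m = subst (All (_≤ m)) L≡ (maxL-≥ (x ∷ xs))
  m∉r : All (m ≢_) r
  m∉r = AllPairs.head (Unique-++⁻ʳ c (subst Unique L≡ u))

-- The block decomposition π_L = π₁ ⋯ π_l

record Block (b : List ℕ) : Set where
  constructor block
  field
    body      : List ℕ
    peak      : ℕ
    shape     : b ≡ body ++ [ peak ]
    body<peak : All (_< peak) body
    unique    : Unique b

record IsBlockDecomposition (L : List ℕ) (bs : List (List ℕ)) : Set where
  field
    blocks-valid : All Block bs
    length-sum   : sum (map length bs) ≡ length L
    empty        : bs ≡ [] → L ≡ []
    des-∷ʳ-<     : ∀ y → All (y <_) L → des (L ++ [ y ]) ≡ sum (map (λ b → des b + 1) bs)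

IsBlockDecomposition-[] : IsBlockDecomposition [] []
IsBlockDecomposition-[] = record { blocks-valid = [] ; length-sum = refl ; empty = λ _ → refl ; des-∷ʳ-< = λ _ _ → refl }

des-++-peak : ∀ c m y ys → y < m → des (c ++ m ∷ y ∷ ys) ≡ des (c ++ [ m ]) + 1 + des (y ∷ ys)
des-++-peak c m y ys y<m = begin
  des (c ++ m ∷ y ∷ ys)                              ≡⟨ des-++-∷-∷ c m y ys ⟩
  des (c ++ [ m ]) + (descent m y + des (y ∷ ys))    ≡⟨ cong (λ k → des (c ++ [ m ]) + (k + des (y ∷ ys))) (descent-> y<m) ⟩
  des (c ++ [ m ]) + (1 + des (y ∷ ys))              ≡⟨ sym (+-assoc (des (c ++ [ m ])) 1 _) ⟩
  des (c ++ [ m ]) + 1 + des (y ∷ ys)                ∎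
  where open ≡-Reasoning

des-++-peak-∷ʳ : ∀ c m r y → All (_< m) (r ++ [ y ]) →
  des ((c ++ m ∷ r) ++ [ y ]) ≡ des (c ++ [ m ]) + 1 + des (r ++ [ y ])
des-++-peak-∷ʳ c m r y r<m rewrite List.++-assoc c (m ∷ r) [ y ] with r | r<m
... | [] | y<m ∷ _ = des-++-peak c m y [] y<m
... | x ∷ r′ | x<m ∷ _ = des-++-peak c m x (r′ ++ [ y ]) x<m

blocksF-decomposition : ∀ f L → length L ≤ f → Unique L → IsBlockDecomposition L (blocksF f L)
blocksF-decomposition zero [] _ _ = IsBlockDecomposition-[]
blocksF-decomposition (suc f) [] _ _ = IsBlockDecomposition-[]
blocksF-decomposition (suc f) (x ∷ xs) (s≤s len≤f) u with peak-split x xs u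
... | c , r , split≡ , L≡ , c<m , r<m rewrite split≡ = record
  { blocks-valid = block c m refl c<m (Unique-++⁻ˡ (c ++ [ m ]) u′) ∷ IsBlockDecomposition.blocks-valid IH
  ; length-sum = begin
      length (c ++ [ m ]) + sum (map length (blocksF f r)) ≡⟨ cong (length (c ++ [ m ]) +_) (IsBlockDecomposition.length-sum IH) ⟩
      length (c ++ [ m ]) + length r                       ≡⟨ sym (List.length-++ (c ++ [ m ])) ⟩
      length ((c ++ [ m ]) ++ r)                           ≡⟨ cong length (sym L≡′) ⟩
      length (x ∷ xs)                                      ∎
  ; empty = λ ()
  ; des-∷ʳ-< = λ y L>y → let cmr>y = subst (All (y <_)) L≡ L>y in begin
      des ((x ∷ xs) ++ [ y ])                 ≡⟨ cong (λ l → des (l ++ [ y ])) L≡ ⟩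
      des ((c ++ m ∷ r) ++ [ y ])             ≡⟨ des-++-peak-∷ʳ c m r y (All.++⁺ r<m (All.head (All.++⁻ʳ c cmr>y) ∷ [])) ⟩
      des (c ++ [ m ]) + 1 + des (r ++ [ y ]) ≡⟨ cong (des (c ++ [ m ]) + 1 +_)
                                                   (IsBlockDecomposition.des-∷ʳ-< IH y (All.tail (All.++⁻ʳ c cmr>y))) ⟩
      _                                       ∎
  }
  where
  open ≡-Reasoning
  m = maxL (x ∷ xs)
  L≡′ : x ∷ xs ≡ (c ++ [ m ]) ++ r
  L≡′ = trans L≡ (sym (List.++-assoc c [ m ] r))
  u′ : Unique ((c ++ [ m ]) ++ r)
  u′ = subst Unique L≡′ u
  r≤f : length r ≤ f
  r≤f = ≤-pred (≤-trans (subst (suc (length r) ≤_) (sym (trans (cong length L≡) (List.length-++ c)))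
                                (m≤n+m (suc (length r)) (length c)))
                         (s≤s len≤f))
  IH = blocksF-decomposition f r r≤f (Unique-++⁻ʳ (c ++ [ m ]) u′)

-- Words of extremal shape

Decreasing : List ℕ → Set
Decreasing [] = ⊤
Decreasing (x ∷ []) = ⊤
Decreasing (x ∷ y ∷ ys) = y < x × Decreasing (y ∷ ys)

ExtremalShape : List ℕ → Set
ExtremalShape [] = ⊤
ExtremalShape (x ∷ xs) = (All (x <_) xs × ExtremalShape xs) ⊎ Decreasing (x ∷ xs)

asc : List ℕ → ℕ
asc τ = length τ ∸ 1 ∸ des τ

descentBound : List ℕ → ℕ
descentBound τ = des τ * asc τ

Decreasing-tail : ∀ x xs → Decreasing (x ∷ xs) → Decreasing xs
Decreasing-tail x [] _ = tt
Decreasing-tail x (y ∷ ys) (_ , dec) = dec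

Decreasing⇒All-< : ∀ x xs → Decreasing (x ∷ xs) → All (_< x) xs
Decreasing⇒All-< x [] _ = []
Decreasing⇒All-< x (y ∷ ys) (y<x , dec) = y<x ∷ All.map (λ z<y → <-trans z<y y<x) (Decreasing⇒All-< y ys dec)

des-Decreasing : ∀ x xs → Decreasing (x ∷ xs) → des (x ∷ xs) ≡ length xs
des-Decreasing x [] _ = refl
des-Decreasing x (y ∷ ys) (y<x , dec) rewrite <⇒<ᵇ≡true y<x = cong suc (des-Decreasing y ys dec)

des≡length⇒Decreasing : ∀ x xs → des (x ∷ xs) ≡ length xs → Decreasing (x ∷ xs)
des≡length⇒Decreasing x [] _ = tt
des≡length⇒Decreasing x (y ∷ ys) e with y <? x
... | yes y<x rewrite <⇒<ᵇ≡true y<x = y<x , des≡length⇒Decreasing y ys (suc-injective e)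
... | no y≮x rewrite ≥⇒<ᵇ≡false (≮⇒≥ y≮x) = ⊥-elim (<-irrefl e (s≤s (des-∷≤length y ys)))

des≡0⇒All-< : ∀ x xs → Unique (x ∷ xs) → des (x ∷ xs) ≡ 0 → All (x <_) xs
des≡0⇒All-< x [] _ _ = []
des≡0⇒All-< x (y ∷ ys) ((x≢y ∷ _) ∷ u) e =
  x<y ∷ All.map (<-trans x<y) (des≡0⇒All-< y ys u (m+n≡0⇒n≡0 (descent x y) e))
  where
  x<y : x < y
  x<y = ≤∧≢⇒< (descent≡0⇒≤ x y (m+n≡0⇒m≡0 (descent x y) e)) x≢y

des≡0⇒ExtremalShape : ∀ xs → Unique xs → des xs ≡ 0 → ExtremalShape xs
des≡0⇒ExtremalShape [] _ _ = tt
des≡0⇒ExtremalShape (x ∷ xs) u@(_ ∷ u′) e =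
  inj₁ (des≡0⇒All-< x xs u e , des≡0⇒ExtremalShape xs u′ (n≤0⇒n≡0 (subst (des xs ≤_) e (des-tail≤ x xs))))

descentBound≡0⇒ExtremalShape : ∀ τ → Unique τ → descentBound τ ≡ 0 → ExtremalShape τ
descentBound≡0⇒ExtremalShape [] _ _ = tt
descentBound≡0⇒ExtremalShape (x ∷ xs) u e with m*n≡0⇒m≡0∨n≡0 (des (x ∷ xs)) e
... | inj₁ des≡0 = des≡0⇒ExtremalShape (x ∷ xs) u des≡0
... | inj₂ gap≡0 = inj₂ (des≡length⇒Decreasing x xs (≤-antisym (des-∷≤length x xs) (m∸n≡0⇒m≤n gap≡0)))

Decreasing-map : ∀ {g} xs → MonotoneOn xs g → Decreasing xs → Decreasing (map g xs)
Decreasing-map [] _ _ = tt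
Decreasing-map (x ∷ []) _ _ = tt
Decreasing-map (x ∷ y ∷ ys) mono (y<x , dec) =
  mono (there (here refl)) (here refl) y<x , Decreasing-map (y ∷ ys) (MonotoneOn-⊆ mono there) dec

Decreasing-map⁻ : ∀ {g} xs → MonotoneOn xs g → Decreasing (map g xs) → Decreasing xs
Decreasing-map⁻ [] _ _ = tt
Decreasing-map⁻ (x ∷ []) _ _ = tt
Decreasing-map⁻ (x ∷ y ∷ ys) mono (gy<gx , dec) =
  MonotoneOn-reflects-< mono (there (here refl)) (here refl) gy<gx , Decreasing-map⁻ (y ∷ ys) (MonotoneOn-⊆ mono there) dec

ExtremalShape-map : ∀ {g} xs → MonotoneOn xs g → ExtremalShape xs → ExtremalShape (map g xs)
ExtremalShape-map [] _ _ = tt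
ExtremalShape-map (x ∷ xs) mono (inj₁ (x< , ext)) =
  inj₁ (All-map-on xs (λ y∈ → mono (here refl) (there y∈)) x< , ExtremalShape-map xs (MonotoneOn-⊆ mono there) ext)
ExtremalShape-map (x ∷ xs) mono (inj₂ dec) = inj₂ (Decreasing-map (x ∷ xs) mono dec)

ExtremalShape-map⁻ : ∀ {g} xs → MonotoneOn xs g → ExtremalShape (map g xs) → ExtremalShape xs
ExtremalShape-map⁻ [] _ _ = tt
ExtremalShape-map⁻ (x ∷ xs) mono (inj₁ (gx< , ext)) =
  inj₁ (All-map-on⁻ xs (λ y∈ → MonotoneOn-reflects-< mono (here refl) (there y∈)) gx< ,
        ExtremalShape-map⁻ xs (MonotoneOn-⊆ mono there) ext)
ExtremalShape-map⁻ (x ∷ xs) mono (inj₂ dec) = inj₂ (Decreasing-map⁻ (x ∷ xs) mono dec)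

greatest-unique : ∀ {x y xs ys} → x ∈ y ∷ ys → y ∈ x ∷ xs → All (_< x) xs → All (_< y) ys → x ≡ y
greatest-unique (here x≡y) _ _ _ = x≡y
greatest-unique (there _) (here y≡x) _ _ = sym y≡x
greatest-unique (there x∈ys) (there y∈xs) xs<x ys<y = ⊥-elim (<-asym (All.lookup ys<y x∈ys) (All.lookup xs<x y∈xs))

least-unique : ∀ {x y xs ys} → x ∈ y ∷ ys → y ∈ x ∷ xs → All (x <_) xs → All (y <_) ys → x ≡ y
least-unique (here x≡y) _ _ _ = x≡y
least-unique (there _) (here y≡x) _ _ = sym y≡x
least-unique (there x∈ys) (there y∈xs) x<xs y<ys = ⊥-elim (<-asym (All.lookup y<ys x∈ys) (All.lookup x<xs y∈xs))

drop-≡-∷ : ∀ {x y : ℕ} {xs ys} → x ≡ y → x ∷ xs ↭ y ∷ ys → xs ↭ ys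
drop-≡-∷ refl = Perm.drop-∷

head-∈-↭ : ∀ {x : ℕ} {xs ys} → x ∷ xs ↭ ys → x ∈ ys
head-∈-↭ p = Perm.∈-resp-↭ p (here refl)

Decreasing-↭⇒≡ : ∀ xs ys → Decreasing xs → Decreasing ys → xs ↭ ys → xs ≡ ys
Decreasing-↭⇒≡ [] [] _ _ _ = refl
Decreasing-↭⇒≡ [] (y ∷ ys) _ _ p = ⊥-elim (0≢1+n (Perm.↭-length p))
Decreasing-↭⇒≡ (x ∷ xs) [] _ _ p = ⊥-elim (1+n≢0 (Perm.↭-length p))
Decreasing-↭⇒≡ (x ∷ xs) (y ∷ ys) decx decy p =
  cong₂ _∷_ x≡y (Decreasing-↭⇒≡ xs ys (Decreasing-tail x xs decx) (Decreasing-tail y ys decy) (drop-≡-∷ x≡y p))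
  where
  x≡y : x ≡ y
  x≡y = greatest-unique (head-∈-↭ p) (head-∈-↭ (↭-sym p)) (Decreasing⇒All-< x xs decx) (Decreasing⇒All-< y ys decy)

-- A least first letter starts an ascent, so a decreasing word with as many descents must be a singleton.
least-first-vs-Decreasing : ∀ x xs y ys → All (x <_) xs → Decreasing (y ∷ ys) →
  x ∷ xs ↭ y ∷ ys → des (x ∷ xs) ≡ des (y ∷ ys) → x ∷ xs ≡ y ∷ ys
least-first-vs-Decreasing x [] y ys _ _ p _ = sym (Perm.↭-singleton-inv (↭-sym p))
least-first-vs-Decreasing x (x′ ∷ xs) y ys x< decy p e = ⊥-elim (<-irrefl refl (begin-strict
  des (x′ ∷ xs)        ≤⟨ des-∷≤length x′ xs ⟩
  length xs            <⟨ n<1+n (length xs) ⟩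
  length (x′ ∷ xs)     ≡⟨ suc-injective (Perm.↭-length p) ⟩
  length ys            ≡⟨ sym (des-Decreasing y ys decy) ⟩
  des (y ∷ ys)         ≡⟨ sym e ⟩
  des (x ∷ x′ ∷ xs)    ≡⟨ des-∷-< x (x′ ∷ xs) x< ⟩
  des (x′ ∷ xs)        ∎))
  where open ≤-Reasoning

ExtremalShape-↭⇒≡ : ∀ xs ys → ExtremalShape xs → ExtremalShape ys → xs ↭ ys → des xs ≡ des ys → xs ≡ ys
ExtremalShape-↭⇒≡ [] [] _ _ _ _ = refl
ExtremalShape-↭⇒≡ [] (y ∷ ys) _ _ p _ = ⊥-elim (0≢1+n (Perm.↭-length p))
ExtremalShape-↭⇒≡ (x ∷ xs) [] _ _ p _ = ⊥-elim (1+n≢0 (Perm.↭-length p))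
ExtremalShape-↭⇒≡ (x ∷ xs) (y ∷ ys) (inj₁ (x< , extx)) (inj₁ (y< , exty)) p e =
  cong₂ _∷_ x≡y (ExtremalShape-↭⇒≡ xs ys extx exty (drop-≡-∷ x≡y p)
                   (trans (sym (des-∷-< x xs x<)) (trans e (des-∷-< y ys y<))))
  where
  x≡y : x ≡ y
  x≡y = least-unique (head-∈-↭ p) (head-∈-↭ (↭-sym p)) x< y<
ExtremalShape-↭⇒≡ (x ∷ xs) (y ∷ ys) (inj₂ decx) (inj₂ decy) p _ = Decreasing-↭⇒≡ (x ∷ xs) (y ∷ ys) decx decy p
ExtremalShape-↭⇒≡ (x ∷ xs) (y ∷ ys) (inj₁ (x< , _)) (inj₂ decy) p e = least-first-vs-Decreasing x xs y ys x< decy p e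
ExtremalShape-↭⇒≡ (x ∷ xs) (y ∷ ys) (inj₂ decx) (inj₁ (y< , _)) p e =
  sym (least-first-vs-Decreasing y ys x xs y< decx (↭-sym p) (sym e))

*-+-superadditive : ∀ a b c d → a * b + c * d ≤ (a + c) * (b + d)
*-+-superadditive a b c d = subst (a * b + c * d ≤_) (sym (expand a b c d)) (m≤m+n _ _)
  where
  expand : ∀ a b c d → (a + c) * (b + d) ≡ (a * b + c * d) + (a * d + c * b)
  expand = solve-∀

-- The slack l (P + p) is what makes the bound strict as soon as π_L is nonempty.
weight-combine : ∀ {v e p s E P} l → v + e ≤ e * p → s ≤ E * P → v + e + s + l * (P + p) ≤ (E + l + e) * (P + p)
weight-combine {v} {e} {p} {s} {E} {P} l we≤ s≤ = begin
  v + e + s + l * (P + p)         ≤⟨ +-monoˡ-≤ (l * (P + p)) (+-mono-≤ we≤ s≤) ⟩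
  e * p + E * P + l * (P + p)     ≤⟨ +-monoˡ-≤ (l * (P + p)) (*-+-superadditive e p E P) ⟩
  (e + E) * (p + P) + l * (P + p) ≡⟨ regroup E P l e p ⟩
  (E + l + e) * (P + p)           ∎
  where
  open ≤-Reasoning
  regroup : ∀ E P l e p → (e + E) * (p + P) + l * (P + p) ≡ (E + l + e) * (P + p)
  regroup = solve-∀

slack-vanishes : ∀ {v k B} → v + k ≤ B → v ≡ B → k ≡ 0
slack-vanishes {v} {k} le refl = n≤0⇒n≡0 (+-cancelˡ-≤ v k 0 (subst (v + k ≤_) (sym (+-identityʳ v)) le))

ascents-arith : ∀ E P l e p → E + P + l + suc (e + p) ∸ 1 ∸ (E + l + e) ≡ P + p
ascents-arith E P l e p = begin
  E + P + l + suc (e + p) ∸ 1 ∸ (E + l + e) ≡⟨ cong (λ n → n ∸ 1 ∸ (E + l + e)) (+-suc (E + P + l) (e + p)) ⟩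
  E + P + l + (e + p) ∸ (E + l + e)       ≡⟨ cong (_∸ (E + l + e)) (regroup E P l e p) ⟩
  P + p + (E + l + e) ∸ (E + l + e)       ≡⟨ m+n∸n≡m (P + p) (E + l + e) ⟩
  P + p                                   ∎
  where
  open ≡-Reasoning
  regroup : ∀ E P l e p → E + P + l + (e + p) ≡ P + p + (E + l + e)
  regroup = solve-∀

module _ {A : Set} where

  sum-map-+ : ∀ (f g : A → ℕ) xs → sum (map (λ x → f x + g x) xs) ≡ sum (map f xs) + sum (map g xs)
  sum-map-+ f g [] = refl
  sum-map-+ f g (x ∷ xs) rewrite sum-map-+ f g xs = +-comm-middle (f x) (g x) _ _
    where
    +-comm-middle : ∀ a b c d → a + b + (c + d) ≡ a + c + (b + d)
    +-comm-middle = solve-∀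

  sum-map-1 : ∀ (xs : List A) → sum (map (λ _ → 1) xs) ≡ length xs
  sum-map-1 [] = refl
  sum-map-1 (x ∷ xs) = cong suc (sum-map-1 xs)

  sum-map-mono : ∀ {f g : A → ℕ} xs → All (λ x → f x ≤ g x) xs → sum (map f xs) ≤ sum (map g xs)
  sum-map-mono [] [] = z≤n
  sum-map-mono (x ∷ xs) (fx≤gx ∷ ps) = +-mono-≤ fx≤gx (sum-map-mono xs ps)

  sum-map-*≤*-sum : ∀ (f g : A → ℕ) xs → sum (map (λ x → f x * g x) xs) ≤ sum (map f xs) * sum (map g xs)
  sum-map-*≤*-sum f g [] = z≤n
  sum-map-*≤*-sum f g (x ∷ xs) = ≤-trans (+-monoʳ-≤ (f x * g x) (sum-map-*≤*-sum f g xs))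
                                         (*-+-superadditive (f x) (g x) _ _)

descentBound+des : ∀ τ → descentBound τ + des τ ≡ des τ * (length τ ∸ des τ)
descentBound+des [] = refl
descentBound+des (x ∷ xs) = begin
  e * (length xs ∸ e) + e   ≡⟨ +-comm (e * (length xs ∸ e)) e ⟩
  e + e * (length xs ∸ e)   ≡⟨ sym (*-suc e (length xs ∸ e)) ⟩
  e * suc (length xs ∸ e)   ≡⟨ cong (e *_) (sym (+-∸-assoc 1 (des-∷≤length x xs))) ⟩
  e * (suc (length xs) ∸ e) ∎
  where
  open ≡-Reasoning
  e = des (x ∷ xs)

-- The upper bound

weightTerm : ℕ → List ℕ → ℕ
weightTerm f b = wF f (st b) + des b

wF-idOrDec : ∀ f π → isIdOrDec π ≡ true → wF (suc f) π ≡ 0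
wF-idOrDec f π e with isIdOrDec π
wF-idOrDec f π refl | true = refl

wF-unfold : ∀ f π L R → isIdOrDec π ≡ false → splitAtOne (π ++ [ suc (length π) ]) ≡ (L , R) →
  wF (suc f) π ≡ weightTerm f R + sum (map (weightTerm f) (blocks L))
wF-unfold f π L R e split≡ with isIdOrDec π
wF-unfold f π L R refl split≡ | false with splitAtOne (π ++ [ suc (length π) ])
wF-unfold f π L R refl refl | false | .(L , R) = refl

WithinBound : ℕ → List ℕ → Set
WithinBound v τ = v ≤ descentBound τ × (v ≡ descentBound τ → ExtremalShape τ)

WeightBound : ℕ → Set
WeightBound f = ∀ τ υ → Normalized (τ ++ υ) → Records τ υ → WithinBound (wF f (τ ++ υ)) τ

WithinBound-0 : ∀ τ → Unique τ → WithinBound 0 τ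
WithinBound-0 τ u = z≤n , λ 0≡bound → descentBound≡0⇒ExtremalShape τ u (sym 0≡bound)

WithinBound-∷-least : ∀ x M v → All (x <_) M → WithinBound v M → WithinBound (v + des M) (x ∷ M)
WithinBound-∷-least x M v x<M (v≤ , v≡⇒ext) =
  subst (v + des M ≤_) bound≡ (+-monoˡ-≤ (des M) v≤) ,
  λ e → inj₁ (x<M , v≡⇒ext (+-cancelʳ-≡ (des M) v _ (trans e (sym bound≡))))
  where
  bound≡ : descentBound M + des M ≡ descentBound (x ∷ M)
  bound≡ = trans (descentBound+des M) (cong (λ e → e * (length M ∸ e)) (sym (des-∷-< x M x<M)))

WithinBound-map⁻ : ∀ {g} v A → MonotoneOn A g → WithinBound v (map g A) → WithinBound v A
WithinBound-map⁻ {g} v A mono (v≤ , v≡⇒ext) =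
  subst (v ≤_) bound≡ v≤ , λ e → ExtremalShape-map⁻ A mono (v≡⇒ext (trans e (sym bound≡)))
  where
  bound≡ : descentBound (map g A) ≡ descentBound A
  bound≡ = cong₂ (λ e n → e * (n ∸ 1 ∸ e)) (des-map A mono) (List.length-map g A)

WeightBound-st : ∀ {f} → WeightBound f → ∀ A B → Unique (A ++ B) → Records A B → WithinBound (wF f (st (A ++ B))) A
WeightBound-st {f} IH A B u rec =
  WithinBound-map⁻ (wF f (st (A ++ B))) A (MonotoneOn-⊆ (rank-MonotoneOn (A ++ B)) ∈-++⁺ˡ)
    (subst (λ σ → WithinBound (wF f σ) (map g A)) (sym st≡)
      (IH (map g A) (map g B) (subst Normalized st≡ (st-normalized (A ++ B) u))
          (Records-map A B (rank-MonotoneOn (A ++ B)) rec)))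
  where
  g = rank (A ++ B)
  st≡ : st (A ++ B) ≡ map g A ++ map g B
  st≡ = List.map-++ g A B

module _ {b} (blk : Block b) where
  open Block blk

  Block-des : des b ≡ des body
  Block-des rewrite shape = des-∷ʳ-> body body<peak

  Block-asc : asc b ≡ length body ∸ des body
  Block-asc rewrite shape = cong₂ (λ n e → n ∸ 1 ∸ e) (length-∷ʳ body peak) (des-∷ʳ-> body body<peak)

  Block-length : length b ≡ des b + asc b + 1
  Block-length = begin
    length b                                      ≡⟨ cong length shape ⟩
    length (body ++ [ peak ])                     ≡⟨ length-∷ʳ body peak ⟩
    suc (length body)                             ≡⟨ cong suc (sym (m+[n∸m]≡n (des≤length body))) ⟩
    suc (des body + (length body ∸ des body))     ≡⟨ +-comm 1 _ ⟩
    des body + (length body ∸ des body) + 1       ≡⟨ cong₂ (λ e a → e + a + 1) (sym Block-des) (sym Block-asc) ⟩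
    des b + asc b + 1                             ∎
    where open ≡-Reasoning

blocks-length : ∀ bs → All Block bs → sum (map length bs) ≡ sum (map des bs) + sum (map asc bs) + length bs
blocks-length bs blks = begin
  sum (map length bs)                                    ≡⟨ cong sum (List.map-cong-local (All.map Block-length blks)) ⟩
  sum (map (λ b → des b + asc b + 1) bs)                 ≡⟨ sum-map-+ (λ b → des b + asc b) (λ _ → 1) bs ⟩
  sum (map (λ b → des b + asc b) bs) + sum (map (λ _ → 1) bs) ≡⟨ cong₂ _+_ (sum-map-+ des asc bs) (sum-map-1 bs) ⟩
  sum (map des bs) + sum (map asc bs) + length bs        ∎
  where open ≡-Reasoning

sum-map-des+1 : ∀ bs → sum (map (λ b → des b + 1) bs) ≡ sum (map des bs) + length bs
sum-map-des+1 bs = trans (sum-map-+ des (λ _ → 1) bs) (cong (sum (map des bs) +_) (sum-map-1 bs))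

des-++-∷-< : ∀ L a M → All (a <_) M → des (L ++ a ∷ M) ≡ des (L ++ [ a ]) + des M
des-++-∷-< L a [] _ = sym (+-identityʳ _)
des-++-∷-< L a (z ∷ zs) (a<z ∷ _) =
  trans (des-++-∷-∷ L a z zs) (cong (λ k → des (L ++ [ a ]) + (k + des (z ∷ zs))) (descent-< a<z))

positive-<1⇒[] : ∀ xs → All (1 ≤_) xs → All (_< 1) xs → xs ≡ []
positive-<1⇒[] [] _ _ = refl
positive-<1⇒[] (x ∷ xs) (1≤x ∷ _) (x<1 ∷ _) = ⊥-elim (<-irrefl refl (≤-<-trans 1≤x x<1))

module WeightStep {f} (IH : WeightBound f) where

  weightTerm-Block≤ : ∀ {b} → Block b → weightTerm f b ≤ des b * asc b
  weightTerm-Block≤ {b} blk@(block c m shape c<m u) = begin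
    wF f (st b) + des b         ≡⟨ cong (wF f (st b) +_) (Block-des blk) ⟩
    wF f (st b) + des c         ≤⟨ +-monoˡ-≤ (des c) (proj₁ (subst (λ b → WithinBound (wF f (st b)) c) (sym shape)
                                      (WeightBound-st {f} IH c [ m ] (subst Unique shape u) (c<m , tt)))) ⟩
    descentBound c + des c      ≡⟨ descentBound+des c ⟩
    des c * (length c ∸ des c)  ≡⟨ cong₂ _*_ (sym (Block-des blk)) (sym (Block-asc blk)) ⟩
    des b * asc b               ∎
    where open ≤-Reasoning

  blocks-weight≤ : ∀ bs → All Block bs → sum (map (weightTerm f) bs) ≤ sum (map des bs) * sum (map asc bs)
  blocks-weight≤ bs blks = ≤-trans (sum-map-mono bs (All.map weightTerm-Block≤ blks)) (sum-map-*≤*-sum des asc bs)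

  WithinBound-++-1∷ : ∀ L M → Unique (L ++ 1 ∷ M) → All (1 <_) L → All (1 <_) M → ∀ v → WithinBound v M →
    WithinBound (v + des M + sum (map (weightTerm f) (blocks L))) (L ++ 1 ∷ M)
  WithinBound-++-1∷ [] M _ _ 1<M v wbM =
    subst (λ v → WithinBound v (1 ∷ M)) (sym (+-identityʳ _)) (WithinBound-∷-least 1 M v 1<M wbM)
  WithinBound-++-1∷ L@(_ ∷ _) M u 1<L 1<M v (v≤ , _) = ≤-trans (m≤m+n _ _) slack≤ , tight
    where
    module D = IsBlockDecomposition (blocksF-decomposition (length L) L ≤-refl (Unique-++⁻ˡ L u))
    bs = blocks L
    S = sum (map (weightTerm f) bs)
    l = length bs
    E = sum (map des bs)
    P = sum (map asc bs)
    -- e and p are the descents and ascents of 1 ∷ M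
    e = des M
    p = length M ∸ des M
    des≡ : des (L ++ 1 ∷ M) ≡ E + l + e
    des≡ = trans (des-++-∷-< L 1 M 1<M) (cong (_+ e) (trans (D.des-∷ʳ-< 1 1<L) (sum-map-des+1 bs)))
    length≡ : length (L ++ 1 ∷ M) ≡ E + P + l + suc (e + p)
    length≡ = trans (List.length-++ L) (cong₂ (λ a b → a + suc b) (trans (sym D.length-sum) (blocks-length bs D.blocks-valid))
                                                                  (sym (m+[n∸m]≡n (des≤length M))))
    bound≡ : descentBound (L ++ 1 ∷ M) ≡ (E + l + e) * (P + p)
    bound≡ = trans (cong₂ (λ d n → d * (n ∸ 1 ∸ d)) des≡ length≡) (cong ((E + l + e) *_) (ascents-arith E P l e p))
    right≤ : v + e ≤ e * p
    right≤ = subst (v + e ≤_) (descentBound+des M) (+-monoˡ-≤ e v≤)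
    slack≤ : v + e + S + l * (P + p) ≤ descentBound (L ++ 1 ∷ M)
    slack≤ = subst (v + e + S + l * (P + p) ≤_) (sym bound≡) (weight-combine {E = E} {P = P} l right≤ (blocks-weight≤ bs D.blocks-valid))
    0<l : 0 < l
    0<l with bs in eq
    ... | [] = case D.empty eq of λ ()
    ... | _ ∷ _ = s≤s z≤n
    tight : v + e + S ≡ descentBound (L ++ 1 ∷ M) → ExtremalShape (L ++ 1 ∷ M)
    tight eq with m*n≡0⇒m≡0∨n≡0 l (slack-vanishes slack≤ eq)
    ... | inj₁ l≡0 = ⊥-elim (<-irrefl (sym l≡0) 0<l)
    ... | inj₂ P+p≡0 = descentBound≡0⇒ExtremalShape (L ++ 1 ∷ M) u
                         (trans bound≡ (trans (cong ((E + l + e) *_) P+p≡0) (*-zeroʳ (E + l + e))))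

  weightBound-1∈τ : ∀ L M υ → Unique (L ++ 1 ∷ M ++ υ) → All (1 ≤_) (L ++ 1 ∷ M ++ υ) → All (_≢ 1) L →
    Records (L ++ 1 ∷ M) υ → WithinBound (weightTerm f (M ++ υ) + sum (map (weightTerm f) (blocks L))) (L ++ 1 ∷ M)
  weightBound-1∈τ L M υ u pos L≢1 rec =
    subst (λ d → WithinBound (wR + d + _) (L ++ 1 ∷ M)) (sym (Records-des M υ recM))
      (WithinBound-++-1∷ L M uτ 1<L 1<M wR (WeightBound-st {f} IH M υ (AllPairs.tail uR) recM))
    where
    wR = wF f (st (M ++ υ))
    uR : Unique (1 ∷ M ++ υ)
    uR = Unique-++⁻ʳ L u
    uτ : Unique (L ++ 1 ∷ M)
    uτ = Unique-++⁻ˡ (L ++ 1 ∷ M) (subst Unique (sym (List.++-assoc L (1 ∷ M) υ)) u)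
    1<L : All (1 <_) L
    1<L = All.zipWith (λ (1≤ , ≢1) → ≤∧≢⇒< 1≤ (λ e → ≢1 (sym e))) (All.++⁻ˡ L pos , L≢1)
    1<M : All (1 <_) M
    1<M = All.zipWith (λ (1≤ , 1≢) → ≤∧≢⇒< 1≤ 1≢)
            (All.++⁻ˡ M (All.tail (All.++⁻ʳ L pos)) , All.++⁻ˡ M (AllPairs.head uR))
    recM : Records M υ
    recM = Records-dropˡ (L ++ [ 1 ]) M υ (subst (λ t → Records t υ) (sym (List.++-assoc L [ 1 ] M)) rec)

  1∈records⇒trivial : ∀ τ P R → All (1 ≤_) (τ ++ P) → Unique R → Records τ (P ++ 1 ∷ R) →
    τ ≡ [] × τ ++ P ≡ [] × weightTerm f R ≡ 0
  1∈records⇒trivial τ P R pos uR rec =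
    List.++-conicalˡ τ P τP≡[] , τP≡[] ,
    cong₂ _+_ (n≤0⇒n≡0 (proj₁ (WeightBound-st {f} IH [] R uR recR))) (Records-des [] R recR)
    where
    split = Records-split τ P 1 R rec
    τP≡[] : τ ++ P ≡ []
    τP≡[] = positive-<1⇒[] (τ ++ P) pos (proj₁ split)
    recR : Records [] R
    recR = Records-dropˡ (τ ++ P ++ [ 1 ]) [] R (subst (λ t → Records t R) (sym (List.++-identityʳ _)) (proj₂ split))

  weightBound-split : ∀ τ υ L R → L ++ 1 ∷ R ≡ τ ++ υ → Unique (L ++ 1 ∷ R) → All (1 ≤_) (L ++ 1 ∷ R) →
    All (_≢ 1) L → Records τ υ → WithinBound (weightTerm f R + sum (map (weightTerm f) (blocks L))) τ
  weightBound-split τ υ L R eq u pos L≢1 rec with ++-∷-cases L 1 R τ υ eq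
  ... | inj₁ (M , refl , refl) = weightBound-1∈τ L M υ u pos L≢1 rec
  ... | inj₂ (P , refl , refl) with 1∈records⇒trivial τ P R (All.++⁻ˡ (τ ++ P) pos) (AllPairs.tail (Unique-++⁻ʳ (τ ++ P) u)) rec
  ...   | τ≡[] , τP≡[] , term≡0 rewrite τP≡[] | term≡0 | τ≡[] = WithinBound-0 [] []

  weightBound-step : ∀ τ υ → Normalized (τ ++ υ) → Records τ υ → isIdOrDec (τ ++ υ) ≡ false →
    WithinBound (wF (suc f) (τ ++ υ)) τ
  weightBound-step τ υ (u , bounded , inj₁ σ≡[]) rec notIdDec = case subst (λ σ → isIdOrDec σ ≡ false) σ≡[] notIdDec of λ ()
  weightBound-step τ υ (u , bounded , inj₂ 1∈σ) rec notIdDec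
    with splitAtOne-spec ((τ ++ υ) ++ [ suc (length (τ ++ υ)) ]) (∈-++⁺ˡ 1∈σ)
  ... | L , R , split≡ , σ⁺≡ , L≢1 =
    subst (λ v → WithinBound v τ) (sym (wF-unfold f (τ ++ υ) L R notIdDec split≡))
      (weightBound-split τ (υ ++ [ z ]) L R (trans (sym σ⁺≡) (List.++-assoc τ υ [ z ]))
        (subst Unique σ⁺≡ (Unique-∷ʳ (τ ++ υ) u (All.map (λ x<z x≡z → <-irrefl x≡z x<z) σ<z)))
        (subst (All (1 ≤_)) σ⁺≡ (All.++⁺ (All.map proj₁ bounded) (s≤s z≤n ∷ [])))
        L≢1 (Records-∷ʳ τ υ z rec σ<z))
    where
    z = suc (length (τ ++ υ))
    σ<z : All (_< z) (τ ++ υ)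
    σ<z = All.map (λ (_ , x≤n) → s≤s x≤n) bounded

weightBound : ∀ f → WeightBound f
weightBound zero τ υ (u , _) _ = WithinBound-0 τ (Unique-++⁻ˡ τ u)
weightBound (suc f) τ υ norm rec = byIdOrDec (isIdOrDec (τ ++ υ)) refl
  where
  byIdOrDec : ∀ b → isIdOrDec (τ ++ υ) ≡ b → WithinBound (wF (suc f) (τ ++ υ)) τ
  byIdOrDec true e = subst (λ v → WithinBound v τ) (sym (wF-idOrDec f (τ ++ υ) e)) (WithinBound-0 τ (Unique-++⁻ˡ τ (proj₁ norm)))
  byIdOrDec false e = WeightStep.weightBound-step (weightBound f) τ υ norm rec e

-- The extremal permutations and the lower bound

nToOne : ℕ → List ℕ
nToOne k = reverse (oneToN k)

nToOne-suc : ∀ k → nToOne (suc k) ≡ suc k ∷ nToOne k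
nToOne-suc k = trans (cong reverse (oneToN-∷ʳ k)) (List.reverse-++ (oneToN k) [ suc k ])

Decreasing-suc∷nToOne : ∀ k → Decreasing (suc k ∷ nToOne k)
Decreasing-suc∷nToOne zero = tt
Decreasing-suc∷nToOne (suc k) =
  subst (λ l → Decreasing (suc (suc k) ∷ l)) (sym (nToOne-suc k)) (n<1+n (suc k) , Decreasing-suc∷nToOne k)

des-nToOne : ∀ d → des (nToOne (suc d)) ≡ d
des-nToOne d = begin
  des (nToOne (suc d))      ≡⟨ cong des (nToOne-suc d) ⟩
  des (suc d ∷ nToOne d)    ≡⟨ des-Decreasing (suc d) (nToOne d) (Decreasing-suc∷nToOne d) ⟩
  length (nToOne d)         ≡⟨ List.length-reverse (oneToN d) ⟩
  length (oneToN d)         ≡⟨ length-oneToN d ⟩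
  d                         ∎
  where open ≡-Reasoning

des-1∷map-suc : ∀ xs → des (1 ∷ map suc xs) ≡ des (map suc xs)
des-1∷map-suc [] = refl
des-1∷map-suc (x ∷ xs) = refl

des-oneToN : ∀ m → des (oneToN m) ≡ 0
des-oneToN zero = refl
des-oneToN (suc m) rewrite oneToN-suc m =
  trans (des-1∷map-suc (oneToN m)) (trans (des-map (oneToN m) suc-MonotoneOn) (des-oneToN m))

extremal′ : ℕ → ℕ → List ℕ
extremal′ a d = oneToN a ++ reverse (map (λ i → suc a + i) (upTo (suc d)))

extremal≡extremal′ : ∀ a d → extremal (d + suc a) d ≡ extremal′ a d
extremal≡extremal′ a d rewrite m+n∸m≡n d (suc a) = refl

extremal′-suc : ∀ a d → extremal′ (suc a) d ≡ 1 ∷ map suc (extremal′ a d)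
extremal′-suc a d = begin
  oneToN (suc a) ++ reverse (map (λ i → suc (suc a) + i) U)   ≡⟨ cong (_++ reverse (map (suc ∘ h) U)) (oneToN-suc a) ⟩
  1 ∷ (map suc (oneToN a) ++ reverse (map (suc ∘ h) U))       ≡⟨ cong (λ l → 1 ∷ (map suc (oneToN a) ++ reverse l)) (List.map-∘ {g = suc} {f = h} U) ⟩
  1 ∷ (map suc (oneToN a) ++ reverse (map suc (map h U)))     ≡⟨ cong (λ l → 1 ∷ (map suc (oneToN a) ++ l)) (sym (List.reverse-map suc (map h U))) ⟩
  1 ∷ (map suc (oneToN a) ++ map suc (reverse (map h U)))     ≡⟨ cong (1 ∷_) (sym (List.map-++ suc (oneToN a) _)) ⟩
  1 ∷ map suc (extremal′ a d)                                 ∎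
  where
  open ≡-Reasoning
  U = upTo (suc d)
  h = λ i → suc a + i

extremal′-↭ : ∀ a d → extremal′ a d ↭ oneToN (d + suc a)
extremal′-↭ zero d = subst (λ m → nToOne (suc d) ↭ oneToN m) (+-comm 1 d) (Perm.↭-reverse (oneToN (suc d)))
extremal′-↭ (suc a) d = subst₂ _↭_ (sym (extremal′-suc a d))
  (trans (sym (oneToN-suc (d + suc a))) (cong oneToN (sym (+-suc d (suc a)))))
  (prep 1 (Perm.map⁺ suc (extremal′-↭ a d)))

des-extremal′ : ∀ a d → des (extremal′ a d) ≡ d
des-extremal′ zero d = des-nToOne d
des-extremal′ (suc a) d rewrite extremal′-suc a d =
  trans (des-1∷map-suc (extremal′ a d)) (trans (des-map (extremal′ a d) suc-MonotoneOn) (des-extremal′ a d))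

ExtremalShape-extremal′ : ∀ a d → ExtremalShape (extremal′ a d)
ExtremalShape-extremal′ zero d = subst ExtremalShape (sym (nToOne-suc d)) (inj₂ (Decreasing-suc∷nToOne d))
ExtremalShape-extremal′ (suc a) d = subst ExtremalShape (sym (extremal′-suc a d))
  (inj₁ (All.map⁺ (All.map s≤s positive) , ExtremalShape-map (extremal′ a d) suc-MonotoneOn (ExtremalShape-extremal′ a d)))
  where
  positive : All (1 ≤_) (extremal′ a d)
  positive = All.map proj₁ (Perm.All-resp-↭ (↭-sym (extremal′-↭ a d)) (oneToN-bounded (d + suc a)))

-- Removing the letter 1 from padded (a + 1) d t and standardizing gives padded a d (t + 1), the maximum appended
-- by the recursion joining the run of new maxima; each such step contributes d to the weight.
shiftedRun : ℕ → ℕ → List ℕ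
shiftedRun N t = map (N +_) (oneToN t)

shiftedRun-∷ʳ : ∀ N t → shiftedRun N (suc t) ≡ shiftedRun N t ++ [ N + suc t ]
shiftedRun-∷ʳ N t = trans (cong (map (N +_)) (oneToN-∷ʳ t)) (List.map-++ (N +_) (oneToN t) [ suc t ])

Records-shiftedRun : ∀ A N t → All (_≤ N) A → Records A (shiftedRun N t)
Records-shiftedRun A N zero _ = tt
Records-shiftedRun A N (suc t) A≤N = subst (Records A) (sym (shiftedRun-∷ʳ N t))
  (Records-∷ʳ A (shiftedRun N t) (N + suc t) (Records-shiftedRun A N t A≤N)
    (All.++⁺ (All.map (λ x≤N → ≤-<-trans x≤N (m<m+n N (s≤s z≤n))) A≤N)
             (All.map⁺ (All.map (λ (_ , i≤t) → +-monoʳ-< N (s≤s i≤t)) (oneToN-bounded t)))))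

oneToN-++-shiftedRun : ∀ N t → oneToN N ++ shiftedRun N t ≡ oneToN (N + t)
oneToN-++-shiftedRun N zero = trans (List.++-identityʳ _) (cong oneToN (sym (+-identityʳ N)))
oneToN-++-shiftedRun N (suc t) = begin
  oneToN N ++ shiftedRun N (suc t)               ≡⟨ cong (oneToN N ++_) (shiftedRun-∷ʳ N t) ⟩
  oneToN N ++ (shiftedRun N t ++ [ N + suc t ])  ≡⟨ sym (List.++-assoc (oneToN N) _ _) ⟩
  (oneToN N ++ shiftedRun N t) ++ [ N + suc t ]  ≡⟨ cong (_++ [ N + suc t ]) (oneToN-++-shiftedRun N t) ⟩
  oneToN (N + t) ++ [ N + suc t ]                ≡⟨ cong (λ k → oneToN (N + t) ++ [ k ]) (+-suc N t) ⟩
  oneToN (N + t) ++ [ suc (N + t) ]              ≡⟨ sym (oneToN-∷ʳ (N + t)) ⟩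
  oneToN (suc (N + t))                           ≡⟨ cong oneToN (sym (+-suc N t)) ⟩
  oneToN (N + suc t)                             ∎
  where open ≡-Reasoning

padded : ℕ → ℕ → ℕ → List ℕ
padded a d t = extremal′ a d ++ shiftedRun (d + suc a) t

padded-↭ : ∀ a d t → padded a d t ↭ oneToN (d + suc a + t)
padded-↭ a d t = subst (padded a d t ↭_) (oneToN-++-shiftedRun (d + suc a) t)
  (Perm.++⁺ʳ (shiftedRun (d + suc a) t) (extremal′-↭ a d))

length-padded : ∀ a d t → length (padded a d t) ≡ d + suc a + t
length-padded a d t = trans (Perm.↭-length (padded-↭ a d t)) (length-oneToN _)

des-padded : ∀ a d t → des (padded a d t) ≡ d
des-padded a d t = trans (Records-des (extremal′ a d) _ (Records-shiftedRun (extremal′ a d) (d + suc a) t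
  (All.map proj₂ (Perm.All-resp-↭ (↭-sym (extremal′-↭ a d)) (oneToN-bounded (d + suc a)))))) (des-extremal′ a d)

padded-step : ∀ a d t → padded (suc a) d t ++ [ suc (length (padded (suc a) d t)) ] ≡ 1 ∷ map suc (padded a d (suc t))
padded-step a d t = begin
  (extremal′ (suc a) d ++ shiftedRun N′ t) ++ [ z ]   ≡⟨ List.++-assoc (extremal′ (suc a) d) _ _ ⟩
  extremal′ (suc a) d ++ (shiftedRun N′ t ++ [ z ])   ≡⟨ cong (_++ (shiftedRun N′ t ++ [ z ])) (extremal′-suc a d) ⟩
  1 ∷ (map suc (extremal′ a d) ++ (shiftedRun N′ t ++ [ z ]))  ≡⟨ cong (λ l → 1 ∷ (map suc (extremal′ a d) ++ l)) run≡ ⟩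
  1 ∷ (map suc (extremal′ a d) ++ map suc (shiftedRun N (suc t))) ≡⟨ cong (1 ∷_) (sym (List.map-++ suc (extremal′ a d) _)) ⟩
  1 ∷ map suc (padded a d (suc t))                              ∎
  where
  open ≡-Reasoning
  N = d + suc a
  N′ = d + suc (suc a)
  z = suc (length (padded (suc a) d t))
  N′≡ : ∀ i → N′ + i ≡ suc (N + i)
  N′≡ i = cong (_+ i) (+-suc d (suc a))
  z≡ : z ≡ suc (N + suc t)
  z≡ = cong suc (trans (length-padded (suc a) d t) (trans (N′≡ t) (sym (+-suc N t))))
  run≡ : shiftedRun N′ t ++ [ z ] ≡ map suc (shiftedRun N (suc t))
  run≡ = begin
    shiftedRun N′ t ++ [ z ]                                     ≡⟨ cong₂ (λ l k → l ++ [ k ]) (List.map-cong N′≡ (oneToN t)) z≡ ⟩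
    map (λ i → suc (N + i)) (oneToN t) ++ [ suc (N + suc t) ]   ≡⟨ cong (_++ [ suc (N + suc t) ]) (List.map-∘ (oneToN t)) ⟩
    map suc (shiftedRun N t) ++ map suc [ N + suc t ]           ≡⟨ sym (List.map-++ suc (shiftedRun N t) _) ⟩
    map suc (shiftedRun N t ++ [ N + suc t ])                   ≡⟨ cong (map suc) (sym (shiftedRun-∷ʳ N t)) ⟩
    map suc (shiftedRun N (suc t))                              ∎

eqList≡true⇒≡ : ∀ xs ys → eqList xs ys ≡ true → xs ≡ ys
eqList≡true⇒≡ [] [] _ = refl
eqList≡true⇒≡ (x ∷ xs) (y ∷ ys) e with x ≡ᵇ y in x≡ᵇy
... | true = cong₂ _∷_ (≡ᵇ≡true⇒≡ x y x≡ᵇy) (eqList≡true⇒≡ xs ys e)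

isIdOrDec≡true : ∀ π → isIdOrDec π ≡ true → π ≡ oneToN (length π) ⊎ π ≡ nToOne (length π)
isIdOrDec≡true π e with eqList π (oneToN (length π)) in isId
... | true = inj₁ (eqList≡true⇒≡ _ _ isId)
... | false = inj₂ (eqList≡true⇒≡ _ _ e)

padded-not-idOrDec : ∀ a d t → isIdOrDec (padded (suc a) (suc d) t) ≡ false
padded-not-idOrDec a d t with isIdOrDec (padded (suc a) (suc d) t) in e
... | false = refl
... | true with isIdOrDec≡true (padded (suc a) (suc d) t) e
...   | inj₁ π≡id = ⊥-elim (1+n≢0 (trans (sym (des-padded (suc a) (suc d) t))
                                      (trans (cong des π≡id) (des-oneToN (length (padded (suc a) (suc d) t))))))
...   | inj₂ π≡dec = ⊥-elim (<-irrefl suc-d≡ suc-d<)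
  where
  m = d + suc (suc a) + t
  suc-d≡ : suc d ≡ m
  suc-d≡ = trans (sym (des-padded (suc a) (suc d) t))
             (trans (cong des π≡dec) (trans (cong (des ∘ nToOne) (length-padded (suc a) (suc d) t)) (des-nToOne m)))
  suc-d< : suc d < m
  suc-d< = ≤-trans (s≤s (s≤s (m≤m+n d a))) (≤-trans (≤-reflexive (sym (trans (+-suc d (suc a)) (cong suc (+-suc d a)))))
                                                        (m≤m+n (d + suc (suc a)) t))

wF-padded≥ : ∀ a d t f → a ≤ f → d * a ≤ wF f (padded a d t)
wF-padded≥ zero d t f _ = subst (_≤ wF f (padded zero d t)) (sym (*-zeroʳ d)) z≤n
wF-padded≥ (suc a) zero t f _ = z≤n
wF-padded≥ (suc a) (suc d) t (suc f) (s≤s a≤f) = begin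
  suc d * suc a                          ≡⟨ *-suc (suc d) a ⟩
  suc d + suc d * a                      ≤⟨ +-monoʳ-≤ (suc d) (wF-padded≥ a (suc d) (suc t) f a≤f) ⟩
  suc d + wF f Y                         ≡⟨ +-comm (suc d) (wF f Y) ⟩
  wF f Y + suc d                         ≡⟨ sym (cong₂ _+_ (cong (wF f) st≡) des≡) ⟩
  weightTerm f (map suc Y)               ≡⟨ sym (+-identityʳ _) ⟩
  weightTerm f (map suc Y) + 0           ≡⟨ sym (wF-unfold f (padded (suc a) (suc d) t) [] (map suc Y)
                                                (padded-not-idOrDec a d t) (cong splitAtOne (padded-step a (suc d) t))) ⟩
  wF (suc f) (padded (suc a) (suc d) t)  ∎
  where
  open ≤-Reasoning
  Y = padded a (suc d) (suc t)
  st≡ : st (map suc Y) ≡ Y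
  st≡ = trans (st-map-suc Y) (st-↭-oneToN _ Y (padded-↭ a (suc d) (suc t)))
  des≡ : des (map suc Y) ≡ suc d
  des≡ = trans (des-map Y suc-MonotoneOn) (des-padded a (suc d) (suc t))

weight-withinBound : ∀ π → Normalized π → WithinBound (w π) π
weight-withinBound π norm =
  subst (λ σ → WithinBound (wF (length π * length π + 1) σ) π) (List.++-identityʳ π)
    (weightBound (length π * length π + 1) π [] (subst Normalized (sym (List.++-identityʳ π)) norm) tt)

module _ n d π (perm : IsPerm n π) (desπ : des π ≡ d) where

  descentBound-perm : descentBound π ≡ d * (n ∸ 1 ∸ d)
  descentBound-perm rewrite proj₂ (↭-oneToN⇒normalized n π perm) | desπ = refl

  weight-perm≤ : w π ≤ d * (n ∸ 1 ∸ d)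
  weight-perm≤ = subst (w π ≤_) descentBound-perm (proj₁ (weight-withinBound π (proj₁ (↭-oneToN⇒normalized n π perm))))

  weight-perm≡⇒ExtremalShape : w π ≡ d * (n ∸ 1 ∸ d) → ExtremalShape π
  weight-perm≡⇒ExtremalShape e =
    proj₂ (weight-withinBound π (proj₁ (↭-oneToN⇒normalized n π perm))) (trans e (sym descentBound-perm))

d+[1+a]∸1∸d≡a : ∀ d a → d + suc a ∸ 1 ∸ d ≡ a
d+[1+a]∸1∸d≡a d a = trans (cong (λ k → k ∸ 1 ∸ d) (+-suc d a)) (m+n∸m≡n d a)

weight-extremal′ : ∀ a d → w (extremal′ a d) ≡ d * a
weight-extremal′ a d = ≤-antisym
  (subst (w (extremal′ a d) ≤_) (cong (d *_) (d+[1+a]∸1∸d≡a d a)) (weight-perm≤ n d _ (extremal′-↭ a d) (des-extremal′ a d)))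
  (subst (λ σ → d * a ≤ wF fuel σ) (List.++-identityʳ (extremal′ a d)) (wF-padded≥ a d 0 fuel a≤fuel))
  where
  n = d + suc a
  fuel = length (extremal′ a d) * length (extremal′ a d) + 1
  a≤fuel : a ≤ fuel
  a≤fuel rewrite trans (Perm.↭-length (extremal′-↭ a d)) (length-oneToN n) | +-suc d a =
    ≤-trans (m≤n+m a (suc d)) (≤-trans (m≤m*n (suc (d + a)) (suc (d + a))) (m≤m+n _ 1))

MaxDescentWeight : ℕ → ℕ → Set
MaxDescentWeight n d =
  (IsPerm n (extremal n d) × des (extremal n d) ≡ d × w (extremal n d) ≡ d * (n ∸ 1 ∸ d))
  × ((π : List ℕ) → IsPerm n π → des π ≡ d → w π ≤ d * (n ∸ 1 ∸ d))
  × ((π : List ℕ) → IsPerm n π → des π ≡ d → w π ≡ d * (n ∸ 1 ∸ d) → π ≡ extremal n d)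

maxDescentWeight : ∀ a d → MaxDescentWeight (d + suc a) d
maxDescentWeight a d rewrite extremal≡extremal′ a d =
  (extremal′-↭ a d , des-extremal′ a d , trans (weight-extremal′ a d) (cong (d *_) (sym (d+[1+a]∸1∸d≡a d a)))) ,
  weight-perm≤ n d ,
  λ π perm desπ w≡ → ExtremalShape-↭⇒≡ π (extremal′ a d)
    (weight-perm≡⇒ExtremalShape n d π perm desπ w≡) (ExtremalShape-extremal′ a d)
    (↭-trans perm (↭-sym (extremal′-↭ a d))) (trans desπ (sym (des-extremal′ a d)))
  where
  n = d + suc a

theorem6p6 : (n d : ℕ) → 1 ≤ n → d ≤ n ∸ 1 →
    (IsPerm n (extremal n d) × des (extremal n d) ≡ d × w (extremal n d) ≡ d * (n ∸ 1 ∸ d))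
    × ((π : List ℕ) → IsPerm n π → des π ≡ d → w π ≤ d * (n ∸ 1 ∸ d))
    × ((π : List ℕ) → IsPerm n π → des π ≡ d → w π ≡ d * (n ∸ 1 ∸ d) → π ≡ extremal n d)
theorem6p6 (suc m) d _ d≤m = subst (λ n → MaxDescentWeight n d) n≡ (maxDescentWeight (m ∸ d) d)
  where
  n≡ : d + suc (m ∸ d) ≡ suc m
  n≡ = trans (+-suc d (m ∸ d)) (cong suc (m+[n∸m]≡n d≤m))
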